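{- Let $k\leq 11$ be a positive integer. Then there exists a positive integer $N(k)$ such that, for every positive integer $n$ all of whose prime factors are greater than $N(k)$, every subset $A\subseteq\mathbb{Z}_n\setminus\{0\}$ with $|A|=k$ and $\sum_{z\in A} z\neq 0$ admits an ordering $(a_1,\dots,a_k)$ whose partial sums $s_i=a_1+\dots+a_i$ ($1\le i\le k$) are all nonzero and pairwise distinct. -}

module Defs where

open import Data.Nat using (ℕ; zero; suc; _+_; _%_; _<_; NonZero)
open import Data.Nat.Primality using (Prime)
open import Data.Nat.Divisibility using (_∣_)
open import Data.Fin using (Fin; toℕ)
open import Data.List using (List; []; _∷_; map)
open import Data.Nat.ListAction using (sum)

-- Elements of ℤ_n are represented by Fin n (residues 0,…,n-1).
-- The sum in ℤ_n of a list of elements, as a residue in ℕ (value < n).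
sumℤ : ∀ (n : ℕ) .{{_ : NonZero n}} → List (Fin n) → ℕ
sumℤ n xs = sum (map toℕ xs) % n

prefixes⁺ : ∀ {A : Set} → List A → List (List A)
prefixes⁺ [] = []
prefixes⁺ (x ∷ xs) = (x ∷ []) ∷ map (x ∷_) (prefixes⁺ xs)

partialSums : ∀ (n : ℕ) .{{_ : NonZero n}} → List (Fin n) → List ℕ
partialSums n xs = map (sumℤ n) (prefixes⁺ xs)

AllPrimeFactorsGreaterThan : ℕ → ℕ → Set
AllPrimeFactorsGreaterThan N n = ∀ p → Prime p → p ∣ n → N < p

-- Dilate A by a suitable d ≤ kᵏ: a pigeonhole over the boxes ⌊k · (d a mod n) / n⌋ (Dirichlet's
-- simultaneous approximation) gives integers w a ≡ d a (mod n) with ∑ |w a| < n.  As every prime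
-- factor of n exceeds kᵏ, d is invertible mod n, so the w a are distinct and nonzero with nonzero sum.
-- Such a set of integers, negated if its sum is negative, can be ordered with positive distinct partial
-- sums: some x satisfies 0 < x < ∑ or x > ∑ (unless the set is {∑}); it goes first, and the rest is
-- ordered recursively.  These partial sums lie in (0, n), hence stay nonzero and pairwise distinct
-- modulo n, and so do the partial sums of A, which are d⁻¹ times them.
module Submission where

open import Defs

module IntegerSequencing where

  open import Algebra.Bundles using (CommutativeMonoid; AbelianGroup)
  open import Data.Integer using (ℤ; +_; -[1+_]; 0ℤ; -_; _+_; ∣_∣; _<_; _≤_; _<?_; _≟_; +≤+; -≤+)
  open import Data.Integer.Properties
  open import Algebra.Properties.Group (AbelianGroup.group +-0-abelianGroup) using (∙-cancelˡ)
  open import Data.List using (List; []; _∷_; [_]; _++_; map; foldr; length)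
  open import Data.List.Properties using (map-++; map-∘; map-cong; length-map)
  open import Data.List.Membership.Propositional using (find)
  open import Data.List.Membership.Propositional.Properties using (∈-∃++)
  open import Data.List.Relation.Unary.All as All using (All; []; _∷_)
  import Data.List.Relation.Unary.All.Properties as All
  open import Data.List.Relation.Unary.Any using (Any; any?)
  open import Data.List.Relation.Unary.AllPairs as AllPairs using (AllPairs; []; _∷_)
  import Data.List.Relation.Unary.AllPairs.Properties as AllPairs
  open import Data.List.Relation.Binary.Permutation.Propositional
    using (_↭_; ↭-sym; ↭-trans; prep; ↭⇒↭ₛ)
  open import Data.List.Relation.Binary.Permutation.Propositional.Properties
    using (All-resp-↭; shift; ↭-length; ↭-map-inv; ∷↭∷ʳ)
  import Data.List.Relation.Binary.Permutation.Setoid.Properties as Perm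
  open import Data.Nat as ℕ using (ℕ; zero; suc)
  import Data.Nat.Properties as ℕ
  open import Data.Nat.ListAction using (sum)
  open import Data.Product using (_×_; _,_; proj₁; proj₂; ∃-syntax)
  open import Function using (_∘_)
  open import Relation.Binary.PropositionalEquality
    using (_≡_; _≢_; refl; sym; trans; cong; cong₂; subst; setoid; resp₂; ≢-sym; module ≡-Reasoning)
  open import Relation.Nullary using (¬_; yes; no; contradiction)
  open import Relation.Nullary.Decidable using (_×-dec_)

  ∑ : List ℤ → ℤ
  ∑ = foldr _+_ 0ℤ

  prefixSums : List ℤ → List ℤ
  prefixSums []       = []
  prefixSums (x ∷ xs) = x ∷ map (_+_ x) (prefixSums xs)

  ∑-↭ : ∀ {xs ys} → xs ↭ ys → ∑ xs ≡ ∑ ys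
  ∑-↭ p = Perm.foldr-commMonoid ℤ+.setoid ℤ+.isCommutativeMonoid (↭⇒↭ₛ p)
    where module ℤ+ = CommutativeMonoid +-0-commutativeMonoid

  ∑-neg : ∀ xs → ∑ (map -_ xs) ≡ - ∑ xs
  ∑-neg []       = refl
  ∑-neg (x ∷ xs) = trans (cong (_+_ (- x)) (∑-neg xs)) (sym (neg-distrib-+ x (∑ xs)))

  ∑-nonpositive : ∀ {xs} → All (_≤ 0ℤ) xs → ∑ xs ≤ 0ℤ
  ∑-nonpositive []       = ≤-refl
  ∑-nonpositive (p ∷ ps) = +-mono-≤ p (∑-nonpositive ps)

  ∑-negative : ∀ {x xs} → All (_< 0ℤ) (x ∷ xs) → ∑ (x ∷ xs) < 0ℤ
  ∑-negative (p ∷ ps) = +-mono-<-≤ p (∑-nonpositive (All.map <⇒≤ ps))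

  prefixSums-neg : ∀ xs → prefixSums (map -_ xs) ≡ map -_ (prefixSums xs)
  prefixSums-neg []       = refl
  prefixSums-neg (x ∷ xs) = cong (- x ∷_) (begin
    map (_+_ (- x)) (prefixSums (map -_ xs))  ≡⟨ cong (map (_+_ (- x))) (prefixSums-neg xs) ⟩
    map (_+_ (- x)) (map -_ (prefixSums xs))  ≡⟨ map-∘ (prefixSums xs) ⟨
    map (λ s → - x + - s) (prefixSums xs)     ≡⟨ map-cong (λ s → sym (neg-distrib-+ x s)) (prefixSums xs) ⟩
    map (λ s → - (x + s)) (prefixSums xs)     ≡⟨ map-∘ (prefixSums xs) ⟩
    map -_ (map (_+_ x) (prefixSums xs))      ∎)
    where open ≡-Reasoning

  prefixSums-∷ʳ : ∀ xs x → prefixSums (xs ++ [ x ]) ≡ prefixSums xs ++ [ ∑ (xs ++ [ x ]) ]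
  prefixSums-∷ʳ []       x = cong [_] (sym (+-identityʳ x))
  prefixSums-∷ʳ (y ∷ xs) x = cong (y ∷_) (begin
    map (_+_ y) (prefixSums (xs ++ [ x ]))                 ≡⟨ cong (map (_+_ y)) (prefixSums-∷ʳ xs x) ⟩
    map (_+_ y) (prefixSums xs ++ [ ∑ (xs ++ [ x ]) ])     ≡⟨ map-++ (_+_ y) (prefixSums xs) _ ⟩
    map (_+_ y) (prefixSums xs) ++ [ ∑ (y ∷ xs ++ [ x ]) ] ∎)
    where open ≡-Reasoning

  i≤+∣i∣ : ∀ i → i ≤ + ∣ i ∣
  i≤+∣i∣ (+ _)    = ≤-refl
  i≤+∣i∣ -[1+ _ ] = -≤+

  prefixSums≤∑∣∣ : ∀ xs → All (_≤ + sum (map ∣_∣ xs)) (prefixSums xs)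
  prefixSums≤∑∣∣ []       = []
  prefixSums≤∑∣∣ (x ∷ xs) =
    ≤-trans (i≤+∣i∣ x) (+≤+ (ℕ.m≤m+n ∣ x ∣ _)) ∷
    All.map⁺ (All.map (λ {s} s≤S → subst (x + s ≤_) (sym (pos-+ ∣ x ∣ (sum (map ∣_∣ xs))))
                                         (+-mono-≤ (i≤+∣i∣ x) s≤S))
                      (prefixSums≤∑∣∣ xs))

  prefixSums-map : ∀ {A : Set} (f : A → ℤ) σ → prefixSums (map f σ) ≡ map (∑ ∘ map f) (prefixes⁺ σ)
  prefixSums-map f []      = refl
  prefixSums-map f (x ∷ σ) = cong₂ _∷_ (sym (+-identityʳ (f x))) (begin
    map (_+_ (f x)) (prefixSums (map f σ))           ≡⟨ cong (map (_+_ (f x))) (prefixSums-map f σ) ⟩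
    map (_+_ (f x)) (map (∑ ∘ map f) (prefixes⁺ σ))  ≡⟨ map-∘ (prefixes⁺ σ) ⟨
    map (λ p → f x + ∑ (map f p)) (prefixes⁺ σ)      ≡⟨ map-∘ (prefixes⁺ σ) ⟩
    map (∑ ∘ map f) (map (x ∷_) (prefixes⁺ σ))       ∎)
    where open ≡-Reasoning

  x<x+y⇒0<y : ∀ x {y} → x < x + y → 0ℤ < y
  x<x+y⇒0<y x {y} lt = ≰⇒> λ y≤0 → <⇒≱ lt (subst (x + y ≤_) (+-identityʳ x) (+-monoʳ-≤ x y≤0))

  x+y<x⇒y<0 : ∀ x {y} → x + y < x → y < 0ℤ
  x+y<x⇒y<0 x {y} lt = ≰⇒> λ 0≤y → <⇒≱ lt (subst (_≤ x + y) (+-identityʳ x) (+-monoʳ-≤ x 0≤y))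

  y<0⇒x+y<x : ∀ x {y} → y < 0ℤ → x + y < x
  y<0⇒x+y<x x y<0 = subst (x + _ <_) (+-identityʳ x) (+-monoʳ-< x y<0)

  NonzeroDistinct : List ℤ → Set
  NonzeroDistinct xs = AllPairs _≢_ xs × All (_≢ 0ℤ) xs

  NonzeroDistinct-↭ : ∀ {xs ys} → xs ↭ ys → NonzeroDistinct xs → NonzeroDistinct ys
  NonzeroDistinct-↭ p (distinct , nonzero) =
    Perm.AllPairs-resp-↭ (setoid ℤ) ≢-sym (resp₂ _≢_) (↭⇒↭ₛ p) distinct , All-resp-↭ p nonzero

  NonzeroDistinct-rest : ∀ {xs x rest} → xs ↭ x ∷ rest → NonzeroDistinct xs → NonzeroDistinct rest
  NonzeroDistinct-rest r nd with _ ∷ distinct , _ ∷ nonzero ← NonzeroDistinct-↭ r nd = distinct , nonzero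

  NonzeroDistinct-neg : ∀ {xs} → NonzeroDistinct xs → NonzeroDistinct (map -_ xs)
  NonzeroDistinct-neg (distinct , nonzero) =
    AllPairs.map⁺ (AllPairs.map (λ x≢y → x≢y ∘ neg-injective) distinct) ,
    All.map⁺ (All.map (λ x≢0 → x≢0 ∘ neg-injective) nonzero)

  Sequencing : (ℤ → Set) → List ℤ → Set
  Sequencing P xs = ∃[ σ ] (σ ↭ xs × All P (prefixSums σ) × AllPairs _≢_ (prefixSums σ))

  Sequencing-neg : ∀ {P xs} → Sequencing P (map -_ xs) → Sequencing (P ∘ -_) xs
  Sequencing-neg (σ , σ↭ , good , distinct) with τ , refl , xs↭τ ← ↭-map-inv -_ (↭-sym σ↭)
    rewrite prefixSums-neg τ =
    τ , ↭-sym xs↭τ , All.map⁻ good , AllPairs.map (λ x≢y → x≢y ∘ cong -_) (AllPairs.map⁻ distinct)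

  prepend : ∀ {P : ℤ → Set} {xs x rest τ} → xs ↭ x ∷ rest → τ ↭ rest → P x →
            All (λ s → s ≢ 0ℤ × P (x + s)) (prefixSums τ) → AllPairs _≢_ (prefixSums τ) →
            Sequencing P xs
  prepend {x = x} {τ = τ} r τ↭rest px good distinct =
    x ∷ τ , ↭-trans (prep x τ↭rest) (↭-sym r) ,
    px ∷ All.map⁺ (All.map proj₂ good) ,
    All.map⁺ (All.map (λ (s≢0 , _) x≡x+s → s≢0 (∙-cancelˡ x _ 0ℤ (trans (sym x≡x+s) (sym (+-identityʳ x)))))
                      good) ∷
    AllPairs.map⁺ (AllPairs.map (λ s≢t → s≢t ∘ ∙-cancelˡ x _ _) distinct)

  append : ∀ {P : ℤ → Set} {xs x rest τ} → xs ↭ x ∷ rest → τ ↭ rest → P (∑ xs) →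
           All (λ s → P s × s < ∑ xs) (prefixSums τ) → AllPairs _≢_ (prefixSums τ) →
           Sequencing P xs
  append {P} {xs} {x} {τ = τ} r τ↭rest pT good distinct =
    τ ++ [ x ] , σ↭xs ,
    subst (All P) (sym sums) (All.++⁺ (All.map proj₁ good) (pT ∷ [])) ,
    subst (AllPairs _≢_) (sym sums) (AllPairs.++⁺ distinct ([] ∷ []) (All.map (λ (_ , s<T) → <⇒≢ s<T ∷ []) good))
    where
    σ↭xs : τ ++ [ x ] ↭ xs
    σ↭xs = ↭-trans (↭-sym (∷↭∷ʳ x τ)) (↭-trans (prep x τ↭rest) (↭-sym r))
    sums : prefixSums (τ ++ [ x ]) ≡ prefixSums τ ++ [ ∑ xs ]
    sums = trans (prefixSums-∷ʳ τ x) (cong (λ t → prefixSums τ ++ [ t ]) (∑-↭ σ↭xs))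

  extract : ∀ {A : Set} {P : A → Set} {xs} → Any P xs → ∃[ x ] ∃[ rest ] (xs ↭ x ∷ rest × P x)
  extract p with x , x∈xs , px ← find p with ys , zs , refl ← ∈-∃++ x∈xs =
    x , ys ++ zs , shift x ys zs , px

  data Selection (xs : List ℤ) : Set where
    inside : ∀ {x rest} → xs ↭ x ∷ rest → 0ℤ < x → 0ℤ < ∑ rest → Selection xs
    above  : ∀ {x rest} → xs ↭ x ∷ rest → ∑ rest < 0ℤ → Selection xs
    only   : ∀ {x} → xs ↭ [ x ] → Selection xs

  negative-tail⇒[] : ∀ {x rest} → All (_< 0ℤ) rest → ∑ (x ∷ rest) ≡ x → rest ≡ []
  negative-tail⇒[] {rest = []}  _   _ = refl
  negative-tail⇒[] {x} {_ ∷ _} neg e = contradiction (y<0⇒x+y<x x (∑-negative neg)) (<-irrefl e)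

  select-degenerate : ∀ {xs} → NonzeroDistinct xs → 0ℤ < ∑ xs →
                      All (λ y → y ≢ ∑ xs → y ≤ 0ℤ) xs → Selection xs
  select-degenerate {xs} nd pos small with any? (_≟ ∑ xs) xs
  ... | no ¬total = contradiction pos
    (≤⇒≯ (∑-nonpositive (All.zipWith (λ (f , y≢T) → f y≢T) (small , All.¬Any⇒All¬ xs ¬total))))
  ... | yes total
    with x , rest , r , refl ← extract total
    with (T≢rest ∷ _) , (_ ∷ nonzero) ← NonzeroDistinct-↭ r nd
    with _ ∷ small-rest ← All-resp-↭ r small
    with refl ← negative-tail⇒[] (All.zipWith (λ ((T≢y , y≢0) , f) → ≤∧≢⇒< (f (≢-sym T≢y)) y≢0)
                                               (All.zip (T≢rest , nonzero) , small-rest))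
                                  (sym (∑-↭ r))
    = only r

  select : ∀ {xs} → NonzeroDistinct xs → 0ℤ < ∑ xs → Selection xs
  select {xs} nd pos with any? (λ x → (0ℤ <? x) ×-dec (x <? ∑ xs)) xs | any? (∑ xs <?_) xs
  ... | yes p | _ with x , rest , r , (0<x , x<T) ← extract p =
    inside r 0<x (x<x+y⇒0<y x (subst (x <_) (∑-↭ r) x<T))
  ... | no _ | yes p with x , rest , r , T<x ← extract p =
    above r (x+y<x⇒y<0 x (subst (_< x) (∑-↭ r) T<x))
  ... | no ¬inside | no ¬above =
    select-degenerate nd pos (All.zipWith bound (All.¬Any⇒All¬ xs ¬inside , All.¬Any⇒All¬ xs ¬above))
    where
    bound : ∀ {y} → ¬ (0ℤ < y × y < ∑ xs) × ¬ (∑ xs < y) → y ≢ ∑ xs → y ≤ 0ℤ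
    bound (¬in , ¬ab) y≢T = ≮⇒≥ λ 0<y → ¬in (0<y , ≤∧≢⇒< (≮⇒≥ ¬ab) y≢T)

  length-rest : ∀ {A : Set} {xs rest : List A} {x m} → xs ↭ x ∷ rest → length xs ≡ suc m → length rest ≡ m
  length-rest r len = ℕ.suc-injective (trans (sym (↭-length r)) len)

  -- The selected x goes first for sequencing⁺ and last for sequencing≤.  When x > ∑ xs the rest has
  -- negative sum and is ordered by the other statement, applied to its negation.
  sequencing⁺ : ∀ m {xs} → length xs ≡ m → NonzeroDistinct xs → 0ℤ < ∑ xs → Sequencing (0ℤ <_) xs
  sequencing≤ : ∀ m {xs} → length xs ≡ m → NonzeroDistinct xs → 0ℤ < ∑ xs →
                Sequencing (λ s → s ≢ 0ℤ × s ≤ ∑ xs) xs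

  sequencing⁺ zero {[]} _ _ pos = contradiction pos (<-irrefl refl)
  sequencing⁺ (suc m) {xs} len nd pos with select nd pos
  ... | inside {x} r 0<x 0<rest
    with τ , τ↭ , good , distinct ← sequencing⁺ m (length-rest r len) (NonzeroDistinct-rest r nd) 0<rest
    = prepend r τ↭ 0<x (All.map (λ 0<s → ≢-sym (<⇒≢ 0<s) , +-mono-< 0<x 0<s) good) distinct
  ... | above {x} {rest} r rest<0
    with τ , τ↭ , good , distinct ← Sequencing-neg (sequencing≤ m
           (trans (length-map -_ rest) (length-rest r len))
           (NonzeroDistinct-neg (NonzeroDistinct-rest r nd))
           (subst (0ℤ <_) (sym (∑-neg rest)) (neg-mono-< rest<0)))
    = prepend r τ↭ (<-trans pos′ (y<0⇒x+y<x x rest<0)) (All.map shifted good) distinct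
    where
    pos′ : 0ℤ < x + ∑ rest
    pos′ = subst (0ℤ <_) (∑-↭ r) pos
    shifted : ∀ {s} → - s ≢ 0ℤ × - s ≤ ∑ (map -_ rest) → s ≢ 0ℤ × 0ℤ < x + s
    shifted (-s≢0 , -s≤) =
      -s≢0 ∘ cong -_ , <-≤-trans pos′ (+-monoʳ-≤ x (neg-cancel-≤ (subst (- _ ≤_) (∑-neg rest) -s≤)))
  ... | only {x} r = [ x ] , ↭-sym r , subst (0ℤ <_) (trans (∑-↭ r) (+-identityʳ x)) pos ∷ [] , [] ∷ []

  sequencing≤ zero {[]} _ _ pos = contradiction pos (<-irrefl refl)
  sequencing≤ (suc m) {xs} len nd pos with select nd pos
  ... | inside {x} {rest} r 0<x 0<rest
    with τ , τ↭ , good , distinct ← sequencing≤ m (length-rest r len) (NonzeroDistinct-rest r nd) 0<rest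
    = append r τ↭ (≢-sym (<⇒≢ pos) , ≤-refl) (All.map below good) distinct
    where
    rest<T : ∑ rest < ∑ xs
    rest<T = subst (∑ rest <_) (sym (∑-↭ r)) (subst (_< x + ∑ rest) (+-identityˡ (∑ rest)) (+-monoˡ-< (∑ rest) 0<x))
    below : ∀ {s} → s ≢ 0ℤ × s ≤ ∑ rest → (s ≢ 0ℤ × s ≤ ∑ xs) × s < ∑ xs
    below (s≢0 , s≤rest) = (s≢0 , <⇒≤ s<T) , s<T
      where s<T = ≤-<-trans s≤rest rest<T
  ... | above {x} {rest} r rest<0
    with τ , τ↭ , good , distinct ← Sequencing-neg (sequencing⁺ m
           (trans (length-map -_ rest) (length-rest r len))
           (NonzeroDistinct-neg (NonzeroDistinct-rest r nd))
           (subst (0ℤ <_) (sym (∑-neg rest)) (neg-mono-< rest<0)))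
    = append r τ↭ (≢-sym (<⇒≢ pos) , ≤-refl) (All.map below good) distinct
    where
    below : ∀ {s} → 0ℤ < - s → (s ≢ 0ℤ × s ≤ ∑ xs) × s < ∑ xs
    below 0<-s = (<⇒≢ s<0 , <⇒≤ (<-trans s<0 pos)) , <-trans s<0 pos
      where s<0 = neg-cancel-< 0<-s
  ... | only {x} r = [ x ] , ↭-sym r , (≢-sym (<⇒≢ pos) ∘ trans (sym x≡T) , ≤-reflexive x≡T) ∷ [] , [] ∷ []
    where
    x≡T : x ≡ ∑ xs
    x≡T = sym (trans (∑-↭ r) (+-identityʳ x))

  positive-sequencing : ∀ {xs} → NonzeroDistinct xs → 0ℤ < ∑ xs → Sequencing (0ℤ <_) xs
  positive-sequencing = sequencing⁺ _ refl

module Congruence where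

  open import Data.Integer using (ℤ; +_; 0ℤ; -_; _+_; _-_; _*_; ∣_∣; _<_; _≤_; +≤+; +<+)
  open import Data.Integer.Properties
  open import Data.Integer.Divisibility.Signed
    using (_∣_; divides; ∣ᵤ⇒∣; ∣⇒∣ᵤ; ∣m∣n⇒∣m+n; ∣m⇒∣-m; ∣n⇒∣m*n)
  open import Data.Integer.DivMod using (a≡a%ℕn+[a/ℕn]*n)
  open import Data.Integer.Tactic.RingSolver using (solve-∀)
  open import Data.Nat as ℕ using (ℕ; zero; suc; NonZero; _%_; _/_; _^_; _∸_; z≤n)
  import Data.Nat.Properties as ℕ
  import Data.Nat.Divisibility as ℕ
  open import Data.Nat.DivMod using (m%n<n; m<n*o⇒m/o<n)
  open import Data.Nat.Coprimality using (Coprime; coprime-divisor)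
  open import Data.Fin as Fin using (Fin; toℕ; fromℕ<; combine)
  open import Data.Fin.Properties using (toℕ-fromℕ<; toℕ<n; pigeonhole; combine-injective)
  open import Data.List using (List; []; _∷_; length)
  open import Data.List.Relation.Unary.All as All using (All; []; _∷_)
  open import Data.Product using (_×_; _,_; ∃-syntax; Σ-syntax)
  open import Relation.Binary.PropositionalEquality
    using (_≡_; refl; sym; trans; cong; cong₂; subst; module ≡-Reasoning)
  open import Relation.Nullary using (contradiction)

  infix 4 _≡_mod_

  -- A record rather than a synonym for + n ∣ a - b, so that a and b can be inferred from it.
  record _≡_mod_ (a b : ℤ) (n : ℕ) : Set where
    constructor ≡-mod
    field divides-difference : + n ∣ a - b

  module _ {n : ℕ} where

    ≡-mod-reflexive : ∀ {a b} → a ≡ b → a ≡ b mod n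
    ≡-mod-reflexive {a} refl = ≡-mod (divides 0ℤ (trans (+-inverseʳ a) (sym (*-zeroˡ (+ n)))))

    ≡-mod-sym : ∀ {a b} → a ≡ b mod n → b ≡ a mod n
    ≡-mod-sym {a} {b} (≡-mod n∣a-b) = ≡-mod (subst (+ n ∣_) (ring a b) (∣m⇒∣-m n∣a-b))
      where
      ring : ∀ a b → - (a - b) ≡ b - a
      ring = solve-∀

    ≡-mod-trans : ∀ {a b c} → a ≡ b mod n → b ≡ c mod n → a ≡ c mod n
    ≡-mod-trans {a} {b} {c} (≡-mod n∣a-b) (≡-mod n∣b-c) =
      ≡-mod (subst (+ n ∣_) (ring a b c) (∣m∣n⇒∣m+n n∣a-b n∣b-c))
      where
      ring : ∀ a b c → (a - b) + (b - c) ≡ a - c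
      ring = solve-∀

    ≡-mod-+ : ∀ {a b c d} → a ≡ b mod n → c ≡ d mod n → a + c ≡ b + d mod n
    ≡-mod-+ {a} {b} {c} {d} (≡-mod n∣a-b) (≡-mod n∣c-d) =
      ≡-mod (subst (+ n ∣_) (ring a b c d) (∣m∣n⇒∣m+n n∣a-b n∣c-d))
      where
      ring : ∀ a b c d → (a - b) + (c - d) ≡ (a + c) - (b + d)
      ring = solve-∀

    ≡-mod-neg : ∀ {a b} → a ≡ b mod n → - a ≡ - b mod n
    ≡-mod-neg {a} {b} (≡-mod n∣a-b) = ≡-mod (subst (+ n ∣_) (ring a b) (∣m⇒∣-m n∣a-b))
      where
      ring : ∀ a b → - (a - b) ≡ - a - - b
      ring = solve-∀

    ≡-mod-*ˡ : ∀ c {a b} → a ≡ b mod n → c * a ≡ c * b mod n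
    ≡-mod-*ˡ c {a} {b} (≡-mod n∣a-b) = ≡-mod (subst (+ n ∣_) (ring c a b) (∣n⇒∣m*n c n∣a-b))
      where
      ring : ∀ c a b → c * (a - b) ≡ c * a - c * b
      ring = solve-∀

    ≡-mod-cancelˡ : ∀ c {a b} → Coprime n ∣ c ∣ → c * a ≡ c * b mod n → a ≡ b mod n
    ≡-mod-cancelˡ c {a} {b} coprime (≡-mod n∣ca-cb) = ≡-mod (∣ᵤ⇒∣ (coprime-divisor coprime
      (subst (n ℕ.∣_) (abs-* c (a - b)) (∣⇒∣ᵤ (subst (+ n ∣_) (ring c a b) n∣ca-cb)))))
      where
      ring : ∀ c a b → c * a - c * b ≡ c * (a - b)
      ring = solve-∀

    ≡-mod⇒≡ : ∀ {a b} → a ≡ b mod n → ∣ a - b ∣ ℕ.< n → a ≡ b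
    ≡-mod⇒≡ {a} {b} (≡-mod n∣a-b) small with ∣ a - b ∣ in eq
    ... | zero  = i-j≡0⇒i≡j a b (∣i∣≡0⇒i≡0 eq)
    ... | suc _ = contradiction (subst (n ℕ.∣_) eq (∣⇒∣ᵤ n∣a-b)) (ℕ.>⇒∤ small)

    %-≡-mod : ∀ m .{{_ : NonZero n}} → + (m % n) ≡ + m mod n
    %-≡-mod m = ≡-mod (divides (- + (m / n))
      (trans (cong (_-_ (+ (m % n))) (a≡a%ℕn+[a/ℕn]*n (+ m) n)) (ring (+ (m % n)) (+ (m / n)) (+ n))))
      where
      ring : ∀ r q n → r - (r + q * n) ≡ - q * n
      ring = solve-∀

  ∣i-j∣<n : ∀ {i j n} → 0ℤ ≤ i → i < + n → 0ℤ ≤ j → j < + n → ∣ i - j ∣ ℕ.< n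
  ∣i-j∣<n {+ a} {+ b} _ (+<+ a<n) _ (+<+ b<n) =
    ℕ.≤-<-trans (subst (ℕ._≤ a ℕ.⊔ b) (cong ∣_∣ (sym (m-n≡m⊖n a b))) (∣m⊝n∣≤m⊔n a b))
                (ℕ.⊔-lub a<n b<n)

  ≡-mod⇒≡-residues : ∀ {n a b} → + a ≡ + b mod n → a ℕ.< n → b ℕ.< n → a ≡ b
  ≡-mod⇒≡-residues a≡b a<n b<n =
    +-injective (≡-mod⇒≡ a≡b (∣i-j∣<n (+≤+ z≤n) (+<+ a<n) (+≤+ z≤n) (+<+ b<n)))

  same-quotient⇒close : ∀ {a b n} .{{_ : NonZero n}} → a / n ≡ b / n → ∣ + a - + b ∣ ℕ.< n
  same-quotient⇒close {a} {b} {n} a/n≡b/n = subst (ℕ._< n) (cong ∣_∣ (sym difference))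
    (∣i-j∣<n (+≤+ z≤n) (+<+ (m%n<n a n)) (+≤+ z≤n) (+<+ (m%n<n b n)))
    where
    ring : ∀ r s q n → (r + q * n) - (s + q * n) ≡ r - s
    ring = solve-∀
    b≡ : + b ≡ + (b % n) + + (a / n) * + n
    b≡ = subst (λ q → + b ≡ + (b % n) + + q * + n) (sym a/n≡b/n) (a≡a%ℕn+[a/ℕn]*n (+ b) n)
    difference : + a - + b ≡ + (a % n) - + (b % n)
    difference = trans (cong₂ _-_ (a≡a%ℕn+[a/ℕn]*n (+ a) n) b≡) (ring (+ (a % n)) (+ (b % n)) (+ (a / n)) (+ n))

  dilation-difference : ∀ {d d′} x → d ℕ.≤ d′ → + (d′ ℕ.* x) - + (d ℕ.* x) ≡ + (d′ ∸ d) * + x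
  dilation-difference {d} {d′} x d≤d′ = begin
    + (d′ ℕ.* x) - + (d ℕ.* x)         ≡⟨ cong (λ d″ → + (d″ ℕ.* x) - + (d ℕ.* x)) (sym (ℕ.m+[n∸m]≡n d≤d′)) ⟩
    + ((d ℕ.+ e) ℕ.* x) - + (d ℕ.* x)  ≡⟨ cong₂ _-_ (trans (pos-* (d ℕ.+ e) x) (cong (_* + x) (pos-+ d e))) (pos-* d x) ⟩
    (+ d + + e) * + x - + d * + x      ≡⟨ ring (+ d) (+ e) (+ x) ⟩
    + e * + x                          ∎
    where
    open ≡-Reasoning
    e = d′ ∸ d
    ring : ∀ a b x → (a + b) * x - a * x ≡ b * x
    ring = solve-∀

  module _ (n K : ℕ) .{{_ : NonZero n}} .{{_ : NonZero K}} where

    residue : ℕ → ℕ → ℕ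
    residue d x = d ℕ.* x % n

    -- ⌊K · residue d x / n⌋
    box : ℕ → ℕ → Fin K
    box d x = fromℕ< (m<n*o⇒m/o<n (ℕ.*-monoʳ-< K (m%n<n (d ℕ.* x) n)))

    boxes : ℕ → (xs : List ℕ) → Fin (K ^ length xs)
    boxes d []       = Fin.zero
    boxes d (x ∷ xs) = combine (box d x) (boxes d xs)

    boxes-injective : ∀ {d d′} xs → boxes d xs ≡ boxes d′ xs → All (λ x → box d x ≡ box d′ x) xs
    boxes-injective []       _  = []
    boxes-injective (x ∷ xs) eq with same , rest ← combine-injective _ _ _ _ eq = same ∷ boxes-injective xs rest

    same-box⇒close : ∀ {d d′} x → box d x ≡ box d′ x → K ℕ.* ∣ + residue d′ x - + residue d x ∣ ℕ.< n
    same-box⇒close {d} {d′} x same = subst (ℕ._< n) scaled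
      (same-quotient⇒close (trans (sym (toℕ-fromℕ< _)) (trans (cong toℕ (sym same)) (toℕ-fromℕ< _))))
      where
      ring : ∀ k a b → k * a - k * b ≡ k * (a - b)
      ring = solve-∀
      scaled : ∣ + (K ℕ.* residue d′ x) - + (K ℕ.* residue d x) ∣ ≡ K ℕ.* ∣ + residue d′ x - + residue d x ∣
      scaled = trans (cong ∣_∣ (trans (cong₂ _-_ (pos-* K _) (pos-* K _)) (ring (+ K) _ _))) (abs-* (+ K) _)

    dirichlet-approximation : (xs : List ℕ) → ∃[ d ] Σ[ w ∈ (ℕ → ℤ) ] (1 ℕ.≤ d × d ℕ.≤ K ^ length xs ×
                                (∀ x → w x ≡ + d * + x mod n) × All (λ x → K ℕ.* ∣ w x ∣ ℕ.< n) xs)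
    dirichlet-approximation xs with i , j , i<j , same ← pigeonhole (ℕ.n<1+n (K ^ length xs)) (λ i → boxes (toℕ i) xs) =
      toℕ j ∸ toℕ i , w , ℕ.m<n⇒0<n∸m i<j ,
      ℕ.≤-trans (ℕ.m∸n≤m (toℕ j) (toℕ i)) (ℕ.s≤s⁻¹ (toℕ<n j)) ,
      congruent , All.map (λ {x} → same-box⇒close {toℕ i} {toℕ j} x) (boxes-injective xs same)
      where
      w : ℕ → ℤ
      w x = + residue (toℕ j) x - + residue (toℕ i) x
      congruent : ∀ x → w x ≡ + (toℕ j ∸ toℕ i) * + x mod n
      congruent x = ≡-mod-trans (≡-mod-+ (%-≡-mod _) (≡-mod-neg (%-≡-mod _)))
                                (≡-mod-reflexive (dilation-difference x (ℕ.<⇒≤ i<j)))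

module ResidueSequencing where

  open IntegerSequencing
  open Congruence

  open import Data.Integer using (ℤ; +_; 0ℤ; -_; _*_; ∣_∣; _<_; +<+)
  open import Data.Integer.Properties
  open import Data.Nat as ℕ using (ℕ; zero; suc; NonZero; _%_; _^_)
  import Data.Nat.Properties as ℕ
  import Data.Nat.Divisibility as ℕ
  open import Data.Nat.DivMod using (m%n<n)
  open import Data.Nat.Coprimality using (Coprime)
  open import Data.Nat.Primality using (Prime)
  open import Data.Nat.Primality.Factorisation using (factorise)
  open import Data.Nat.ListAction using (sum)
  import Data.Nat.ListAction.Properties as ℕ
  open import Data.Nat.Tactic.RingSolver using () renaming (solve-∀ to ℕ-solve-∀)
  open import Data.Fin using (Fin; toℕ)
  open import Data.Fin.Properties using (toℕ<n; toℕ-injective)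
  open import Data.List using (List; []; _∷_; map; length)
  open import Data.List.Properties using (map-∘; map-cong; length-map)
  open import Data.List.Relation.Unary.All as All using (All; []; _∷_)
  import Data.List.Relation.Unary.All.Properties as All
  open import Data.List.Relation.Unary.AllPairs as AllPairs using (AllPairs; []; _∷_)
  import Data.List.Relation.Unary.AllPairs.Properties as AllPairs
  open import Data.List.Relation.Binary.Permutation.Propositional using (_↭_; ↭-sym)
  import Data.List.Relation.Binary.Permutation.Propositional.Properties as Perm
  open import Data.Product using (_×_; _,_; proj₁; proj₂; ∃-syntax)
  open import Function using (_∘_)
  open import Relation.Binary.Definitions using (tri<; tri≈; tri>)
  open import Relation.Binary.PropositionalEquality
    using (_≡_; _≢_; refl; sym; trans; cong; subst)
  open import Relation.Nullary using (contradiction)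

  prime-factor : ∀ m → ∃[ p ] (Prime p × p ℕ.∣ suc (suc m))
  prime-factor m with factorise (suc (suc m))
  ... | record { factors = [] ; isFactorisation = () }
  ... | record { factors = p ∷ _ ; isFactorisation = m≡Πps ; factorsPrime = p-prime ∷ _ } =
    p , p-prime , subst (p ℕ.∣_) (sym m≡Πps) (ℕ.m∣m*n _)

  small⇒coprime : ∀ {N n d} → AllPrimeFactorsGreaterThan N n → 1 ℕ.≤ d → d ℕ.≤ N → Coprime n d
  small⇒coprime _     1≤d _   {zero}        (_ , 0∣d)  = contradiction (ℕ.0∣⇒≡0 0∣d) (ℕ.m<n⇒n≢0 1≤d)
  small⇒coprime _     _   _   {suc zero}    _          = refl
  small⇒coprime rough 1≤d d≤N {suc (suc m)} (e∣n , e∣d) with p , p-prime , p∣e ← prime-factor m =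
    contradiction (ℕ.≤-trans (ℕ.∣⇒≤ p∣e) (ℕ.≤-trans (ℕ.∣⇒≤ ⦃ ℕ.>-nonZero 1≤d ⦄ e∣d) d≤N))
                  (ℕ.<⇒≱ (rough p p-prime (ℕ.∣-trans p∣e e∣n)))

  sum<n : ∀ {K n} .{{_ : NonZero K}} ms → All (λ m → K ℕ.* m ℕ.< n) ms → length ms ≡ K → sum ms ℕ.< n
  sum<n {K} {n} ms bounds refl =
    ℕ.*-cancelˡ-≤ K (subst (ℕ._≤ K ℕ.* n) (trans (ℕ.+-comm _ K) (sym (ℕ.*-suc K (sum ms)))) (weighted ms bounds))
    where
    rearrange : ∀ K m s l → suc (K ℕ.* m) ℕ.+ (K ℕ.* s ℕ.+ l) ≡ K ℕ.* (m ℕ.+ s) ℕ.+ suc l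
    rearrange = ℕ-solve-∀
    weighted : ∀ ms → All (λ m → K ℕ.* m ℕ.< n) ms → K ℕ.* sum ms ℕ.+ length ms ℕ.≤ length ms ℕ.* n
    weighted []       []              = ℕ.≤-reflexive (trans (ℕ.+-identityʳ _) (ℕ.*-zeroʳ K))
    weighted (m ∷ ms) (Km<n ∷ bounds) = subst (ℕ._≤ n ℕ.+ length ms ℕ.* n) (rearrange K m (sum ms) (length ms))
                                              (ℕ.+-mono-≤ Km<n (weighted ms bounds))

  ∑-≡-mod : ∀ {A : Set} {f : A → ℤ} {g : A → ℕ} {c n} → (∀ a → f a ≡ c * + g a mod n) →
            ∀ p → ∑ (map f p) ≡ c * + sum (map g p) mod n
  ∑-≡-mod {c = c} congruent []          = ≡-mod-reflexive (sym (*-zeroʳ c))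
  ∑-≡-mod {g = g} {c} congruent (a ∷ p) = ≡-mod-trans (≡-mod-+ (congruent a) (∑-≡-mod {g = g} {c} congruent p))
    (≡-mod-reflexive (trans (sym (*-distribˡ-+ c (+ g a) (+ sum (map g p)))) (cong (c *_) (sym (pos-+ (g a) _)))))

  residues-nonzero-distinct : ∀ {L : Set} {g : L → ℤ} {r : L → ℕ} {c n} →
    (∀ p → g p ≡ c * + r p mod n) → ∀ {ps} →
    All (λ p → 0ℤ < g p × g p < + n) ps → AllPairs (λ p q → g p ≢ g q) ps →
    All (λ p → r p ≢ 0) ps × AllPairs (λ p q → r p ≢ r q) ps
  residues-nonzero-distinct {g = g} {r} {c} {n} congruent = go
    where
    nonzero : ∀ {p} → 0ℤ < g p × g p < + n → r p ≢ 0
    nonzero {p} (0<g , g<n) r≡0 = <⇒≢ 0<g (sym (≡-mod⇒≡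
      (≡-mod-trans (congruent p) (≡-mod-reflexive (trans (cong (λ m → c * + m) r≡0) (*-zeroʳ c))))
      (∣i-j∣<n (<⇒≤ 0<g) g<n ≤-refl (<-trans 0<g g<n))))
    separated : ∀ {p q} → 0ℤ < g p × g p < + n → 0ℤ < g q × g q < + n → g p ≢ g q → r p ≢ r q
    separated {p} {q} (0<gp , gp<n) (0<gq , gq<n) gp≢gq rp≡rq = gp≢gq (≡-mod⇒≡
      (≡-mod-trans (congruent p) (≡-mod-trans (≡-mod-reflexive (cong (λ m → c * + m) rp≡rq)) (≡-mod-sym (congruent q))))
      (∣i-j∣<n (<⇒≤ 0<gp) gp<n (<⇒≤ 0<gq) gq<n))
    go : ∀ {ps} → All (λ p → 0ℤ < g p × g p < + n) ps → AllPairs (λ p q → g p ≢ g q) ps →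
         All (λ p → r p ≢ 0) ps × AllPairs (λ p q → r p ≢ r q) ps
    go []       []       = [] , []
    go (b ∷ bs) (d ∷ ds) with nonzeros , distinct ← go bs ds =
      nonzero b ∷ nonzeros , All.zipWith (λ (b′ , d′) → separated b b′ d′) (bs , d) ∷ distinct

  Sequenceable : ∀ n .{{_ : NonZero n}} → List (Fin n) → Set
  Sequenceable n A = ∃[ σ ] (σ ↭ A × All (λ s → s ≢ 0) (partialSums n σ) × AllPairs _≢_ (partialSums n σ))

  module _ {n : ℕ} .{{_ : NonZero n}} {c : ℤ} {w : ℕ → ℤ}
           (coprime : Coprime n ∣ c ∣) (congruent : ∀ x → w x ≡ c * + x mod n) where

    dilation-cancel : ∀ {x y} → x ℕ.< n → y ℕ.< n → w x ≡ c * + y mod n → x ≡ y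
    dilation-cancel {x} x<n y<n wx≡cy =
      ≡-mod⇒≡-residues (≡-mod-cancelˡ c coprime (≡-mod-trans (≡-mod-sym (congruent x)) wx≡cy)) x<n y<n

    dilated-NonzeroDistinct : ∀ {A : List (Fin n)} → AllPairs _≢_ A → All (λ a → toℕ a ≢ 0) A →
                              NonzeroDistinct (map (w ∘ toℕ) A)
    dilated-NonzeroDistinct distinct nonzero =
      AllPairs.map⁺ (AllPairs.map (λ {a} {b} a≢b wa≡wb → a≢b (toℕ-injective (dilation-cancel (toℕ<n a) (toℕ<n b)
        (≡-mod-trans (≡-mod-reflexive wa≡wb) (congruent (toℕ b)))))) distinct) ,
      All.map⁺ (All.map (λ {a} a≢0 wa≡0 → a≢0 (dilation-cancel (toℕ<n a) (ℕ.>-nonZero⁻¹ n)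
        (≡-mod-reflexive (trans wa≡0 (sym (*-zeroʳ c)))))) nonzero)

    dilated-sum≢0 : ∀ (A : List (Fin n)) → sumℤ n A ≢ 0 → ∑ (map (w ∘ toℕ) A) ≢ 0ℤ
    dilated-sum≢0 A sum≢0 ∑≡0 =
      sum≢0 (≡-mod⇒≡-residues (≡-mod-cancelˡ c coprime c[S%n]≡c0) (m%n<n S n) (ℕ.>-nonZero⁻¹ n))
      where
      S = sum (map toℕ A)
      c[S%n]≡c0 : c * + (S % n) ≡ c * 0ℤ mod n
      c[S%n]≡c0 = ≡-mod-trans (≡-mod-*ˡ c (%-≡-mod S))
        (≡-mod-trans (≡-mod-sym (∑-≡-mod {g = toℕ} {c} (congruent ∘ toℕ) A))
                     (≡-mod-reflexive (trans ∑≡0 (sym (*-zeroʳ c)))))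

    partialSums-nonzero-distinct : ∀ σ → All (λ s → 0ℤ < s × s < + n) (prefixSums (map (w ∘ toℕ) σ)) →
      AllPairs _≢_ (prefixSums (map (w ∘ toℕ) σ)) →
      All (λ s → s ≢ 0) (partialSums n σ) × AllPairs _≢_ (partialSums n σ)
    partialSums-nonzero-distinct σ bounded separated = All.map⁺ (proj₁ residues) , AllPairs.map⁺ (proj₂ residues)
      where
      g : List (Fin n) → ℤ
      g p = ∑ (map (w ∘ toℕ) p)
      sums : prefixSums (map (w ∘ toℕ) σ) ≡ map g (prefixes⁺ σ)
      sums = prefixSums-map (w ∘ toℕ) σ
      congruence : ∀ p → g p ≡ c * + sumℤ n p mod n
      congruence p = ≡-mod-trans (∑-≡-mod {g = toℕ} {c} (congruent ∘ toℕ) p) (≡-mod-*ˡ c (≡-mod-sym (%-≡-mod _)))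
      residues : All (λ p → sumℤ n p ≢ 0) (prefixes⁺ σ) × AllPairs (λ p q → sumℤ n p ≢ sumℤ n q) (prefixes⁺ σ)
      residues = residues-nonzero-distinct {g = g} {sumℤ n} {c} congruence
        (All.map⁻ (subst (All (λ s → 0ℤ < s × s < + n)) sums bounded))
        (AllPairs.map⁻ (subst (AllPairs _≢_) sums separated))

    sequenceable-of-ordering : ∀ {A : List (Fin n)} → sum (map (∣_∣ ∘ w ∘ toℕ) A) ℕ.< n →
                               Sequencing (0ℤ <_) (map (w ∘ toℕ) A) → Sequenceable n A
    sequenceable-of-ordering {A} small (τ , τ↭ , positive , separated)
      with σ , refl , A↭σ ← Perm.↭-map-inv (w ∘ toℕ) (↭-sym τ↭) =
      σ , ↭-sym A↭σ , partialSums-nonzero-distinct σ (All.zip {P = 0ℤ <_} {Q = _< + n} (positive , bounded)) separated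
      where
      total : sum (map ∣_∣ (map (w ∘ toℕ) σ)) ≡ sum (map (∣_∣ ∘ w ∘ toℕ) A)
      total = trans (sym (cong sum (map-∘ σ))) (ℕ.sum-↭ (Perm.map⁺ (∣_∣ ∘ w ∘ toℕ) (↭-sym A↭σ)))
      bounded : All (_< + n) (prefixSums (map (w ∘ toℕ) σ))
      bounded = All.map (λ s≤ → ≤-<-trans s≤ (+<+ (subst (ℕ._< n) (sym total) small)))
                        (prefixSums≤∑∣∣ (map (w ∘ toℕ) σ))

    sequenceable-of-positive : ∀ (A : List (Fin n)) → sum (map (∣_∣ ∘ w ∘ toℕ) A) ℕ.< n →
      AllPairs _≢_ A → All (λ a → toℕ a ≢ 0) A → 0ℤ < ∑ (map (w ∘ toℕ) A) → Sequenceable n A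
    sequenceable-of-positive A small distinct nonzero pos =
      sequenceable-of-ordering small (positive-sequencing (dilated-NonzeroDistinct distinct nonzero) pos)

  sequenceable : ∀ {n} .{{_ : NonZero n}} {c w} → Coprime n ∣ c ∣ → (∀ x → w x ≡ c * + x mod n) →
    ∀ (A : List (Fin n)) → sum (map (∣_∣ ∘ w ∘ toℕ) A) ℕ.< n →
    AllPairs _≢_ A → All (λ a → toℕ a ≢ 0) A → sumℤ n A ≢ 0 → Sequenceable n A
  sequenceable {n} {c} {w} coprime congruent A small distinct nonzero sum≢0 with <-cmp (∑ (map (w ∘ toℕ) A)) 0ℤ
  ... | tri> _ _ pos  = sequenceable-of-positive {c = c} coprime congruent A small distinct nonzero pos
  ... | tri≈ _ ∑≡0 _ = contradiction ∑≡0 (dilated-sum≢0 {c = c} coprime congruent A sum≢0)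
  ... | tri< neg _ _  = sequenceable-of-positive {c = - c} {w = -_ ∘ w}
    (subst (Coprime n) (sym (∣-i∣≡∣i∣ c)) coprime)
    (λ x → subst (λ z → - w x ≡ z mod n) (neg-distribˡ-* c (+ x)) (≡-mod-neg (congruent x)))
    A (subst (ℕ._< n) (cong sum (map-cong (λ a → sym (∣-i∣≡∣i∣ (w (toℕ a)))) A)) small) distinct nonzero
    (subst (0ℤ <_) (sym (trans (cong ∑ (map-∘ A)) (∑-neg (map (w ∘ toℕ) A)))) (neg-mono-< neg))

  sequenceable-of-rough : ∀ {K n} .{{_ : NonZero K}} .{{_ : NonZero n}} → AllPrimeFactorsGreaterThan (K ^ K) n →
    ∀ (A : List (Fin n)) → AllPairs _≢_ A → length A ≡ K → All (λ a → toℕ a ≢ 0) A → sumℤ n A ≢ 0 →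
    Sequenceable n A
  sequenceable-of-rough {K} {n} rough A distinct |A|≡K nonzero sum≢0 =
    let d , w , 1≤d , d≤Kˡ , congruent , short = dirichlet-approximation n K (map toℕ A) in
    sequenceable {c = + d} (small⇒coprime rough 1≤d (subst (λ l → d ℕ.≤ K ^ l) length≡K d≤Kˡ)) congruent A
      (sum<n _ (subst (All (λ m → K ℕ.* m ℕ.< n)) (sym (map-∘ A)) (All.map⁺ short)) (trans (length-map _ A) |A|≡K))
      distinct nonzero sum≢0
    where
    length≡K : length (map toℕ A) ≡ K
    length≡K = trans (length-map toℕ A) |A|≡K

open ResidueSequencing using (sequenceable-of-rough)

open import Data.Nat using (ℕ; suc; _≤_; NonZero; _^_)
open import Data.Nat.Properties using (m^n>0)
open import Data.Fin using (Fin; toℕ)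
open import Data.List using (List; length)
open import Data.List.Relation.Unary.All using (All)
open import Data.List.Relation.Unary.AllPairs using (AllPairs)
open import Data.List.Relation.Binary.Permutation.Propositional using (_↭_)
open import Data.Product using (_×_; _,_; ∃-syntax)
open import Relation.Binary.PropositionalEquality using (_≡_; _≢_)

corollary3p2 : (k : ℕ) → 1 ≤ k → k ≤ 11 →
    ∃[ N ] (1 ≤ N × (∀ (n : ℕ) .{{_ : NonZero n}} → AllPrimeFactorsGreaterThan N n →
      ∀ (A : List (Fin n)) → AllPairs _≢_ A → length A ≡ k →
      All (λ a → toℕ a ≢ 0) A → sumℤ n A ≢ 0 →
      ∃[ σ ] (σ ↭ A × All (λ s → s ≢ 0) (partialSums n σ) × AllPairs _≢_ (partialSums n σ))))
corollary3p2 k@(suc _) _ _ = k ^ k , m^n>0 k k , λ _ → sequenceable-of-rough
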